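{- For every integer $n\ge 1$, there is a bijection between the set of Elenas with $n$ nodes and the set of planted plane trees with $n$ nodes and height at most $4$, where the height of a planted plane tree is the maximal number of nodes on a path from the root to a node (equivalently, every node is at distance at most $3$ edges from the root).
   Context: Planted plane trees are rooted trees in which the children of every node are linearly ordered (left to right). An Elena is a planted plane tree of the following form: there are nodes $v_1,\dots,v_k$ ($k\ge 1$), with $v_1$ the root, such that for each $i<k$ the node $v_{i+1}$ is the rightmost child of $v_i$, the node $v_k$ is a leaf, and for each $i<k$ every other child of $v_i$ (there may be any number $\ge 0$ of them, placed to the left of $v_{i+1}$) is the top node of a path, i.e. a chain of $\ge 1$ nodes each of which has at most one child. Equivalently, Elenas are encoded by the words of the rational language $(\mathtt{a}\,\mathtt{p}^*)^*\mathtt{a}$, where $\mathtt{a}$ stands for the next node on the rightmost branch and $\mathtt{p}$ for a path of arbitrary length $\ge1$ attached to the current rightmost-branch node. Under the standard bijection between planted plane trees with $n$ nodes and Dyck paths of length $2(n-1)$, Elenas correspond exactly to nondecreasing Dyck paths (Dyck paths whose sequence of valley altitudes is nondecreasing). The size of an Elena is its number of nodes. -}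

module Defs where

open import Data.Nat using (ℕ; zero; suc; _+_; _⊔_)
open import Data.List using (List; []; _∷_; _++_; [_])
open import Data.List.Relation.Unary.All using (All)

-- Planted plane trees: a node with an ordered (left-to-right) list of subtrees.
data Tree : Set where
  node : List Tree → Tree

mutual
  size : Tree → ℕ
  size (node ts) = suc (sizeF ts)

  sizeF : List Tree → ℕ
  sizeF []       = zero
  sizeF (t ∷ ts) = size t + sizeF ts

mutual
  height : Tree → ℕ
  height (node ts) = suc (heightF ts)

  heightF : List Tree → ℕ
  heightF []       = zero
  heightF (t ∷ ts) = height t ⊔ heightF ts

data IsPath : Tree → Set where
  path-end  : IsPath (node [])
  path-step : ∀ {t} → IsPath t → IsPath (node [ t ])

-- An Elena: rightmost branch v1..vk with vk a leaf; every other child of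
-- each vi (i < k) is the top node of a path, placed left of v(i+1).
data IsElena : Tree → Set where
  elena-leaf : IsElena (node [])
  elena-step : ∀ {ps t} → All IsPath ps → IsElena t → IsElena (node (ps ++ [ t ]))

module Submission where

-- Both families are coded by the same combinatorial objects: a list of
-- blocks, each block a list of natural numbers (type Code).
--   * An Elena with spine v₁ … v_k has one block per spine node v₁ … v_{k-1};
--     the block of vᵢ lists the lengths (edges) of the paths hanging left of
--     v_{i+1}.
--   * A tree of height ≤ 4 has one block per child of the root; the block of
--     such a child lists the numbers of (leaf) children of its own children.
-- Both codings are invertible, and in both cases the number of nodes is the
-- same function codeWeight of the code.  A general lemma (restrictToSize)
-- turns an inverse that carries a size function to a weight function into a
-- bijection between the sets of elements of a given size; the theorem is then
-- the composite of the two restricted bijections through Code.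

open import Defs
open import Data.Nat using (ℕ; _≤_; _≥_)
open import Data.Product using (Σ; _×_)
open import Function.Bundles using (_⤖_)
open import Relation.Binary.PropositionalEquality using (_≡_)

open import Data.Nat using (zero; suc; _+_; z≤n; s≤s; s≤s⁻¹)
open import Data.Nat.Properties using (≡-irrelevant; ≤-irrelevant; ⊔-lub; m⊔n≤o⇒m≤o; m⊔n≤o⇒n≤o; +-assoc; +-suc; +-identityʳ)
open import Data.List using (List; []; _∷_; _++_; [_]; map; replicate; length)
open import Data.Nat.ListAction using (sum)
open import Data.List.Properties using (map-∘; map-id-local; length-replicate)
open import Data.List.Relation.Unary.All as All using (All; []; _∷_; universal)
open import Data.List.Relation.Unary.All.Properties using (map⁺; replicate⁺)
open import Data.Product using (_,_; proj₁; proj₂)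
open import Function.Base using (_∘_)
open import Function.Bundles using (_↔_; Inverse; mk↔ₛ′)
open import Function.Properties.Inverse using (↔⇒⤖)
open import Function.Construct.Composition using (_↔-∘_)
open import Function.Construct.Symmetry using (↔-sym)
open import Relation.Binary.PropositionalEquality using (refl; sym; trans; cong; cong₂; module ≡-Reasoning)

restrictToSize : {A C : Set} {P : A → Set} (size′ : A → ℕ) (w : C → ℕ) (e : Σ A P ↔ C) →
                 (∀ c → size′ (proj₁ (Inverse.from e c)) ≡ w c) →
                 (n : ℕ) → Σ A (λ a → P a × size′ a ≡ n) ↔ Σ C (λ c → w c ≡ n)
restrictToSize {A} {C} {P} size′ w e from-size n = mk↔ₛ′ to′ from′ to∘from from∘to
  where
  open Inverse e

  to-size : ∀ x → w (to x) ≡ size′ (proj₁ x)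
  to-size x = trans (sym (from-size (to x))) (cong (size′ ∘ proj₁) (strictlyInverseʳ x))

  to′ : Σ A (λ a → P a × size′ a ≡ n) → Σ C (λ c → w c ≡ n)
  to′ (a , p , s) = to (a , p) , trans (to-size (a , p)) s

  from′ : Σ C (λ c → w c ≡ n) → Σ A (λ a → P a × size′ a ≡ n)
  from′ (c , s) = proj₁ (from c) , proj₂ (from c) , trans (from-size c) s

  -- size proofs are irrelevant, so equality is decided by the first components
  ≡-onC : ∀ {c c′} → c ≡ c′ → (s : w c ≡ n) (s′ : w c′ ≡ n) → (c , s) ≡ (c′ , s′)
  ≡-onC refl s s′ = cong (_ ,_) (≡-irrelevant s s′)

  ≡-onA : ∀ {x x′ : Σ A P} → x ≡ x′ → (s : size′ (proj₁ x) ≡ n) (s′ : size′ (proj₁ x′) ≡ n) →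
          (proj₁ x , proj₂ x , s) ≡ (proj₁ x′ , proj₂ x′ , s′)
  ≡-onA refl s s′ = cong (λ s″ → _ , _ , s″) (≡-irrelevant s s′)

  to∘from : ∀ y → to′ (from′ y) ≡ y
  to∘from (c , s) = ≡-onC (strictlyInverseˡ c) _ s

  from∘to : ∀ x → from′ (to′ x) ≡ x
  from∘to (a , p , s) = ≡-onA (strictlyInverseʳ (a , p)) _ s

-- Codes and their weight: one node for the root, and per block one node plus
-- k+1 nodes for every entry k.
Code : Set
Code = List (List ℕ)

blockWeight : List ℕ → ℕ
blockWeight b = sum (map suc b)

codeWeight : Code → ℕ
codeWeight c = suc (sum (map (suc ∘ blockWeight) c))

leaf : Tree
leaf = node []

sizeF-map : {A : Set} {f : A → Tree} {g : A → ℕ} → (∀ x → size (f x) ≡ g x) →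
            ∀ xs → sizeF (map f xs) ≡ sum (map g xs)
sizeF-map eq []       = refl
sizeF-map eq (x ∷ xs) = cong₂ _+_ (eq x) (sizeF-map eq xs)

sizeF-++ : ∀ ts us → sizeF (ts ++ us) ≡ sizeF ts + sizeF us
sizeF-++ []       us = refl
sizeF-++ (t ∷ ts) us = trans (cong (size t +_) (sizeF-++ ts us)) (sym (+-assoc (size t) (sizeF ts) (sizeF us)))

map-inverse-on : {A B : Set} {f : A → B} {g : B → A} {xs : List A} →
                 All (λ x → g (f x) ≡ x) xs → map g (map f xs) ≡ xs
map-inverse-on {xs = xs} inv = trans (sym (map-∘ xs)) (map-id-local inv)

pathOf : ℕ → Tree
pathOf zero    = leaf
pathOf (suc k) = node [ pathOf k ]

pathOf-isPath : ∀ k → IsPath (pathOf k)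
pathOf-isPath zero    = path-end
pathOf-isPath (suc k) = path-step (pathOf-isPath k)

pathLength : ∀ {t} → IsPath t → ℕ
pathLength path-end      = zero
pathLength (path-step p) = suc (pathLength p)

size-pathOf : ∀ k → size (pathOf k) ≡ suc k
size-pathOf zero    = refl
size-pathOf (suc k) = cong suc (trans (+-identityʳ (size (pathOf k))) (size-pathOf k))

elenaOf : Code → Tree
elenaOf []      = leaf
elenaOf (b ∷ c) = node (map pathOf b ++ [ elenaOf c ])

elenaOf-isElena : ∀ c → IsElena (elenaOf c)
elenaOf-isElena []      = elena-leaf
elenaOf-isElena (b ∷ c) = elena-step (map⁺ (universal pathOf-isPath b)) (elenaOf-isElena c)

elenaCode : ∀ {t} → IsElena t → Code
elenaCode elena-leaf        = []
elenaCode (elena-step ps e) = All.reduce pathLength ps ∷ elenaCode e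

elenaCode-elenaOf : ∀ c → elenaCode (elenaOf-isElena c) ≡ c
elenaCode-elenaOf []      = refl
elenaCode-elenaOf (b ∷ c) = cong₂ _∷_ (pathLengths b) (elenaCode-elenaOf c)
  where
  pathLength-pathOf : ∀ k → pathLength (pathOf-isPath k) ≡ k
  pathLength-pathOf zero    = refl
  pathLength-pathOf (suc k) = cong suc (pathLength-pathOf k)

  pathLengths : ∀ b → All.reduce pathLength (map⁺ (universal pathOf-isPath b)) ≡ b
  pathLengths []      = refl
  pathLengths (k ∷ b) = cong₂ _∷_ (pathLength-pathOf k) (pathLengths b)

elenaOf-elenaCode : ∀ {t} (e : IsElena t) →
                    _≡_ {A = Σ Tree IsElena} (elenaOf (elenaCode e) , elenaOf-isElena (elenaCode e)) (t , e)
elenaOf-elenaCode elena-leaf        = refl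
elenaOf-elenaCode (elena-step ps e) = step-cong (paths ps) (elenaOf-elenaCode e)
  where
  step-cong : ∀ {ps ps′ a a′ t t′ e e′} →
              _≡_ {A = Σ (List Tree) (All IsPath)} (ps , a) (ps′ , a′) →
              _≡_ {A = Σ Tree IsElena} (t , e) (t′ , e′) →
              _≡_ {A = Σ Tree IsElena} (node (ps ++ [ t ]) , elena-step a e) (node (ps′ ++ [ t′ ]) , elena-step a′ e′)
  step-cong refl refl = refl

  path : ∀ {t} (p : IsPath t) →
         _≡_ {A = Σ Tree IsPath} (pathOf (pathLength p) , pathOf-isPath (pathLength p)) (t , p)
  path path-end      = refl
  path (path-step p) = cong (λ x → node [ proj₁ x ] , path-step (proj₂ x)) (path p)

  paths : ∀ {ts} (ps : All IsPath ts) →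
          _≡_ {A = Σ (List Tree) (All IsPath)}
              (map pathOf (All.reduce pathLength ps) , map⁺ (universal pathOf-isPath (All.reduce pathLength ps)))
              (ts , ps)
  paths []       = refl
  paths (p ∷ ps) = cong₂ (λ x xs → proj₁ x ∷ proj₁ xs , proj₂ x ∷ proj₂ xs) (path p) (paths ps)

size-elenaOf : ∀ c → size (elenaOf c) ≡ codeWeight c
size-elenaOf []      = refl
size-elenaOf (b ∷ c) = begin
  suc (sizeF (map pathOf b ++ [ elenaOf c ]))       ≡⟨ cong suc (sizeF-++ (map pathOf b) [ elenaOf c ]) ⟩
  suc (sizeF (map pathOf b) + (size (elenaOf c) + 0)) ≡⟨ cong suc (cong₂ _+_ (sizeF-map size-pathOf b) spine) ⟩
  suc (blockWeight b + codeWeight c)                ≡⟨ cong suc (+-suc (blockWeight b) _) ⟩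
  codeWeight (b ∷ c)                                ∎
  where
  open ≡-Reasoning
  spine : size (elenaOf c) + 0 ≡ codeWeight c
  spine = trans (+-identityʳ (size (elenaOf c))) (size-elenaOf c)

elenaCodes : Σ Tree IsElena ↔ Code
elenaCodes = mk↔ₛ′ (elenaCode ∘ proj₂) (λ c → elenaOf c , elenaOf-isElena c)
                   elenaCode-elenaOf (elenaOf-elenaCode ∘ proj₂)

All⇒heightF≤ : ∀ {h ts} → All (λ t → height t ≤ h) ts → heightF ts ≤ h
All⇒heightF≤ []       = z≤n
All⇒heightF≤ (p ∷ ps) = ⊔-lub p (All⇒heightF≤ ps)

heightF≤⇒All : ∀ {h} ts → heightF ts ≤ h → All (λ t → height t ≤ h) ts
heightF≤⇒All []       _ = []
heightF≤⇒All (t ∷ ts) b = m⊔n≤o⇒m≤o (height t) _ b ∷ heightF≤⇒All ts (m⊔n≤o⇒n≤o (height t) _ b)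

children : Tree → List Tree
children (node ts) = ts

children-bounded : ∀ {h} t → height t ≤ suc h → All (λ u → height u ≤ h) (children t)
children-bounded (node ts) b = heightF≤⇒All ts (s≤s⁻¹ b)

arity : Tree → ℕ
arity t = length (children t)

profile : Tree → List ℕ
profile t = map arity (children t)

shape : Tree → Code
shape t = map profile (children t)

star : ℕ → Tree
star k = node (replicate k leaf)

bush : List ℕ → Tree
bush b = node (map star b)

shallowTree : Code → Tree
shallowTree c = node (map bush c)

shallowTree-height : ∀ c → height (shallowTree c) ≤ 4
shallowTree-height c = s≤s (All⇒heightF≤ (map⁺ (universal bush-height c)))
  where
  star-height : ∀ k → height (star k) ≤ 2
  star-height k = s≤s (All⇒heightF≤ (replicate⁺ k (s≤s z≤n)))

  bush-height : ∀ b → height (bush b) ≤ 3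
  bush-height b = s≤s (All⇒heightF≤ (map⁺ (universal star-height b)))

shape-shallowTree : ∀ c → shape (shallowTree c) ≡ c
shape-shallowTree c = map-inverse-on (universal profile-bush c)
  where
  profile-bush : ∀ b → profile (bush b) ≡ b
  profile-bush b = map-inverse-on (universal (λ k → length-replicate k) b)

leaf-unique : ∀ {t} → height t ≤ 1 → leaf ≡ t
leaf-unique {node []}               _ = refl
leaf-unique {node (node vs ∷ us)} b with children-bounded (node (node vs ∷ us)) b
... | () ∷ _

star-arity : ∀ {t} → height t ≤ 2 → star (arity t) ≡ t
star-arity {node ts} b = cong node (leaves (All.map leaf-unique (children-bounded (node ts) b)))
  where
  leaves : ∀ {us} → All (leaf ≡_) us → replicate (length us) leaf ≡ us
  leaves []       = refl
  leaves (p ∷ ps) = cong₂ _∷_ p (leaves ps)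

bush-profile : ∀ {t} → height t ≤ 3 → bush (profile t) ≡ t
bush-profile {node ts} b = cong node (map-inverse-on (All.map star-arity (children-bounded (node ts) b)))

shallowTree-shape : ∀ {t} → height t ≤ 4 → shallowTree (shape t) ≡ t
shallowTree-shape {node ts} b = cong node (map-inverse-on (All.map bush-profile (children-bounded (node ts) b)))

size-shallowTree : ∀ c → size (shallowTree c) ≡ codeWeight c
size-shallowTree c = cong suc (sizeF-map size-bush c)
  where
  leaves : ∀ k → sizeF (replicate k leaf) ≡ k
  leaves zero    = refl
  leaves (suc k) = cong suc (leaves k)

  size-star : ∀ k → size (star k) ≡ suc k
  size-star k = cong suc (leaves k)

  size-bush : ∀ b → size (bush b) ≡ suc (blockWeight b)
  size-bush b = cong suc (sizeF-map size-star b)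

-- trees of height ≤ 4 are coded bijectively; height proofs are irrelevant
shallowCodes : Σ Tree (λ t → height t ≤ 4) ↔ Code
shallowCodes = mk↔ₛ′ (shape ∘ proj₁) (λ c → shallowTree c , shallowTree-height c)
                     shape-shallowTree (λ x → bounded-≡ (shallowTree-shape (proj₂ x)))
  where
  bounded-≡ : ∀ {t t′} {b : height t ≤ 4} {b′ : height t′ ≤ 4} →
              t ≡ t′ → _≡_ {A = Σ Tree (λ t → height t ≤ 4)} (t , b) (t′ , b′)
  bounded-≡ {b = b} {b′} refl = cong (_ ,_) (≤-irrelevant b b′)

mainTheorem1 : (n : ℕ) → n ≥ 1 →
    (Σ Tree (λ t → IsElena t × size t ≡ n)) ⤖ (Σ Tree (λ t → height t ≤ 4 × size t ≡ n))
mainTheorem1 n _ = ↔⇒⤖ (↔-sym shallowBySize ↔-∘ elenasBySize)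
  where
  elenasBySize : Σ Tree (λ t → IsElena t × size t ≡ n) ↔ Σ Code (λ c → codeWeight c ≡ n)
  elenasBySize = restrictToSize size codeWeight elenaCodes size-elenaOf n

  shallowBySize : Σ Tree (λ t → height t ≤ 4 × size t ≡ n) ↔ Σ Code (λ c → codeWeight c ≡ n)
  shallowBySize = restrictToSize size codeWeight shallowCodes size-shallowTree n
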